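{- Let $G$ be a finite, simple, undirected graph that is disconnected. If $G$ is a unigraph, then $G$ has at most one connected component with at least three vertices.
   Context: For a graph $G$, its degree set is the multiset $D(G)=\{\!\{\deg_G(v) : v\in V(G)\}\!\}$ (every vertex, including isolated ones, contributes its degree). A graph $G$ is a unigraph if every graph $H$ with $D(H)=D(G)$ is isomorphic to $G$. -}

module Defs where

open import Data.Nat using (ℕ; zero; suc; _≤_)
open import Data.Bool using (Bool; true; false; _≟_)
open import Data.Fin using (Fin)
open import Data.List using (List; map; filter; length)
open import Data.List.Relation.Binary.Permutation.Propositional using (_↭_)
open import Data.Product using (Σ; _×_; ∃-syntax; _,_)
open import Relation.Binary.PropositionalEquality using (_≡_; _≢_)
open import Relation.Nullary using (¬_)
open import Data.Bool using (T)
open import Function.Bundles using (_↔_)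
open import Function.Bundles using (Inverse)
open import Data.List using (allFin)
open import Data.List.Relation.Unary.Unique.Propositional using (Unique)
open import Data.List.Relation.Unary.All using (All)

record Graph (n : ℕ) : Set where
  field
    adj       : Fin n → Fin n → Bool
    symmetric : ∀ u v → adj u v ≡ adj v u
    irrefl    : ∀ v → adj v v ≡ false
open Graph public

deg : ∀ {n} → Graph n → Fin n → ℕ
deg G v = length (filter (λ u → adj G v u ≟ true) (allFin _))

-- degree multiset, represented as the list of degrees up to permutation
degList : ∀ {n} → Graph n → List ℕ
degList G = map (deg G) (allFin _)

SameDegreeSet : ∀ {n m} → Graph n → Graph m → Set
SameDegreeSet G H = degList G ↭ degList H

Isomorphic : ∀ {n m} → Graph n → Graph m → Set
Isomorphic {n} {m} G H =
  Σ (Fin n ↔ Fin m) λ f → ∀ u v → adj H (Inverse.to f u) (Inverse.to f v) ≡ adj G u v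

Unigraph : ∀ {n} → Graph n → Set
Unigraph {n} G = ∀ {m} (H : Graph m) → SameDegreeSet H G → Isomorphic H G

data Reach {n} (G : Graph n) : Fin n → Fin n → Set where
  here : ∀ {v} → Reach G v v
  step : ∀ {u w v} → T (adj G u w) → Reach G w v → Reach G u v

Connected : ∀ {n} → Graph n → Set
Connected G = ∀ u v → Reach G u v

Disconnected : ∀ {n} → Graph n → Set
Disconnected G = ¬ Connected G

-- the connected component containing v has at least k vertices:
-- there are k distinct vertices all reachable from v
ComponentAtLeast : ∀ {n} → Graph n → ℕ → Fin n → Set
ComponentAtLeast G k v =
  ∃[ xs ] (Unique xs × All (Reach G v) xs × k ≤ length xs)

module Submission where

-- Suppose u and v lie in different components, both with ≥ 3 vertices.
-- A greedy longest-path argument gives, in each of them, a *terminal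
-- edge* ab: either b is a leaf hanging off a, or ab lies on a cycle.
-- Take such edges ab (near u) and cd (near v) and perform the 2-switch
-- ab, cd ↦ ac, bd.  It preserves every degree, so, G being a unigraph,
-- the result H is isomorphic to G.  Two isomorphism invariants, both
-- counts of ordered vertex pairs, then give a contradiction:
--  * if ab (or cd) lies on a cycle, every pair connected in G stays
--    connected in H, and a, c become connected: more connected pairs;
--  * if b and d are both leaves, the isolated edges of G survive in H
--    (ab, cd are not isolated: their components have ≥ 3 vertices) and
--    bd is a new isolated edge: more isolated-edge pairs.
-- Reachability is decided by breadth-first search, so the final case
-- split on whether u reaches v is constructive.

open import Defs
open import Data.Nat using (ℕ; zero; suc; _≤_; _<_; z≤n; s≤s; _≡ᵇ_)
open import Data.Nat.Properties
  using (≤-refl; ≤-trans; ≤-reflexive; <-≤-trans; m<1+n⇒m≤n; <-irrefl; <⇒≱; m≤n+m; +-mono-≤; +-mono-<-≤; +-mono-≤-<;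
         +-0-commutativeMonoid; ≡ᵇ⇒≡)
open import Data.Bool using (Bool; true; false; T; not; _∧_; _∨_)
import Data.Bool as Bool
open import Data.Bool.Properties using (∨-zeroʳ; ∧-zeroʳ; ∧-comm; ∨-comm; T-≡; ⇔→≡)
open import Data.Fin using (Fin; zero; suc; _≟_)
open import Data.Fin.Properties using (any?; suc-injective)
import Data.Fin.Permutation as Perm
import Data.Fin.Permutation.Components as PermC
open import Data.List using (List; []; _∷_; length; filter; tabulate; allFin)
open import Data.List.Properties using (map-cong)
open import Data.List.Relation.Binary.Permutation.Propositional using (↭-reflexive)
open import Data.List.Relation.Unary.All using (_∷_)
open import Data.List.Relation.Unary.AllPairs using (_∷_)
open import Data.Product using (_×_; _,_; proj₁; proj₂; ∃; uncurry)
open import Data.Sum using (_⊎_; inj₁; inj₂; [_,_])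
open import Data.Empty using (⊥; ⊥-elim)
open import Function.Bundles using (_↔_; Inverse; mk⇔; Equivalence)
open import Relation.Nullary using (¬_; Dec; yes; no; does; _×-dec_)
open import Relation.Nullary.Decidable using (dec-true; dec-false)
open import Relation.Binary.PropositionalEquality
import Algebra.Properties.CommutativeMonoid.Sum as CommutativeMonoidSum

toT : ∀ {b} → b ≡ true → T b
toT = Equivalence.from T-≡

fromT : ∀ {b} → T b → b ≡ true
fromT = Equivalence.to T-≡

true≢false : true ≡ false → ⊥
true≢false ()

∨-introˡ : ∀ {a b} → a ≡ true → a ∨ b ≡ true
∨-introˡ refl = refl

∨-introʳ : ∀ a {b} → b ≡ true → a ∨ b ≡ true
∨-introʳ a refl = ∨-zeroʳ a

∨-elim : ∀ a {b} → a ∨ b ≡ true → a ≡ true ⊎ b ≡ true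
∨-elim true  _ = inj₁ refl
∨-elim false e = inj₂ e

∨-false : ∀ a {b} → a ∨ b ≡ false → a ≡ false × b ≡ false
∨-false false e = refl , e

∧-intro : ∀ {a b} → a ≡ true → b ≡ true → a ∧ b ≡ true
∧-intro refl refl = refl

∧-elim : ∀ a {b} → a ∧ b ≡ true → a ≡ true × b ≡ true
∧-elim true e = refl , e

not-true : ∀ {b} → not b ≡ true → b ≡ false
not-true {false} _ = refl

¬false⇒true : ∀ {b} → (b ≡ false → ⊥) → b ≡ true
¬false⇒true {false} h = ⊥-elim (h refl)
¬false⇒true {true}  _ = refl

¬true⇒false : ∀ {b} → (b ≡ true → ⊥) → b ≡ false
¬true⇒false {false} _ = refl
¬true⇒false {true}  h = ⊥-elim (h refl)

_==_ : ∀ {n} → Fin n → Fin n → Bool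
x == y = does (x ≟ y)

==-refl : ∀ {n} (x : Fin n) → x == x ≡ true
==-refl x = dec-true (x ≟ x) refl

==-sound : ∀ {n} {x y : Fin n} → x == y ≡ true → x ≡ y
==-sound {x = x} {y} e with x ≟ y
... | yes p = p

==-false : ∀ {n} {x y : Fin n} → x ≢ y → x == y ≡ false
==-false {x = x} {y} = dec-false (x ≟ y)

==-false⇒≢ : ∀ {n} {x y : Fin n} → x == y ≡ false → x ≢ y
==-false⇒≢ {x = x} e refl = true≢false (trans (sym (==-refl x)) e)

⊆-or-new : ∀ {n} (h g : Fin n → Bool) →
           (∀ z → h z ≡ true → g z ≡ true) ⊎ (∃ λ z → h z ≡ true × g z ≡ false)
⊆-or-new h g with any? (λ z → h z Bool.≟ true ×-dec g z Bool.≟ false)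
... | yes witness = inj₂ witness
... | no none     = inj₁ λ z hz → ¬false⇒true (λ gz → none (z , hz , gz))


module ℕ-Sum = CommutativeMonoidSum +-0-commutativeMonoid

∑ : ∀ {n} → (Fin n → ℕ) → ℕ
∑ = ℕ-Sum.sum

∑-mono : ∀ {n} {f g : Fin n → ℕ} → (∀ i → f i ≤ g i) → ∑ f ≤ ∑ g
∑-mono {zero}  le = z≤n
∑-mono {suc n} le = +-mono-≤ (le zero) (∑-mono (λ i → le (suc i)))

∑-mono-< : ∀ {n} {f g : Fin n → ℕ} → (∀ i → f i ≤ g i) → ∀ j → f j < g j → ∑ f < ∑ g
∑-mono-< {suc n} le zero    lt = +-mono-<-≤ lt (∑-mono (λ i → le (suc i)))
∑-mono-< {suc n} le (suc j) lt = +-mono-≤-< (le zero) (∑-mono-< (λ i → le (suc i)) j lt)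

∑-permute : ∀ {n} (f : Fin n → ℕ) (π : Fin n ↔ Fin n) → ∑ (λ i → f (Inverse.to π i)) ≡ ∑ f
∑-permute f π = sym (ℕ-Sum.sum-permute f π)

𝟙 : Bool → ℕ
𝟙 true  = 1
𝟙 false = 0

count : ∀ {n} → (Fin n → Bool) → ℕ
count g = ∑ (λ i → 𝟙 (g i))

count-cong : ∀ {n} {g h : Fin n → Bool} → (∀ i → g i ≡ h i) → count g ≡ count h
count-cong e = ℕ-Sum.sum-cong-≗ (λ i → cong 𝟙 (e i))

count-permute : ∀ {n} (g : Fin n → Bool) (π : Fin n ↔ Fin n) → count (λ i → g (Inverse.to π i)) ≡ count g
count-permute g = ∑-permute (λ i → 𝟙 (g i))

𝟙-mono : ∀ {a b} → (a ≡ true → b ≡ true) → 𝟙 a ≤ 𝟙 b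
𝟙-mono {false} _ = z≤n
𝟙-mono {true}  h rewrite h refl = ≤-refl

𝟙-< : ∀ {a b} → a ≡ false → b ≡ true → 𝟙 a < 𝟙 b
𝟙-< refl refl = s≤s z≤n

count-< : ∀ {n} {g h : Fin n → Bool} → (∀ i → g i ≡ true → h i ≡ true) →
          ∀ j → g j ≡ false → h j ≡ true → count g < count h
count-< g⊆h j gj hj = ∑-mono-< (λ i → 𝟙-mono (g⊆h i)) j (𝟙-< gj hj)

count≤n : ∀ {n} (g : Fin n → Bool) → count g ≤ n
count≤n {zero}  g = z≤n
count≤n {suc n} g = +-mono-≤ (𝟙≤1 (g zero)) (count≤n (λ i → g (suc i)))
  where
  𝟙≤1 : ∀ b → 𝟙 b ≤ 1
  𝟙≤1 true  = s≤s z≤n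
  𝟙≤1 false = z≤n

count-pos : ∀ {n} (g : Fin n → Bool) y → g y ≡ true → 1 ≤ count g
count-pos g zero    e rewrite e = s≤s z≤n
count-pos g (suc y) e = ≤-trans (count-pos (λ i → g (suc i)) y e) (m≤n+m _ (𝟙 (g zero)))

count≥2 : ∀ {n} (g : Fin n → Bool) y z → g y ≡ true → g z ≡ true → y ≢ z → 2 ≤ count g
count≥2 g zero    zero    _  _  y≢z = ⊥-elim (y≢z refl)
count≥2 g zero    (suc z) gy gz _   rewrite gy = s≤s (count-pos (λ i → g (suc i)) z gz)
count≥2 g (suc y) zero    gy gz _   rewrite gz = s≤s (count-pos (λ i → g (suc i)) y gy)
count≥2 g (suc y) (suc z) gy gz y≢z =
  ≤-trans (count≥2 (λ i → g (suc i)) y z gy gz (λ e → y≢z (cong suc e))) (m≤n+m _ (𝟙 (g zero)))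

count-empty : ∀ {n} (g : Fin n → Bool) → (∀ z → g z ≡ false) → count g ≡ 0
count-empty {zero}  g none = refl
count-empty {suc n} g none rewrite none zero = count-empty (λ i → g (suc i)) (λ i → none (suc i))

count-singleton : ∀ {n} (g : Fin n → Bool) a → g a ≡ true → (∀ z → g z ≡ true → z ≡ a) → count g ≡ 1
count-singleton g zero ga only rewrite ga = cong suc (count-empty _ λ i → others-false i)
  where
  others-false : ∀ i → g (suc i) ≡ false
  others-false i with g (suc i) in e
  ... | false = refl
  ... | true with only (suc i) e
  ... | ()
count-singleton g (suc a) ga only with g zero in e
... | true with only zero e
... | ()
count-singleton g (suc a) ga only | false =
  count-singleton (λ i → g (suc i)) a ga (λ z gz → suc-injective (only (suc z) gz))

count-swap : ∀ {n} (g h : Fin n → Bool) p q → h p ≡ g q → h q ≡ g p →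
  (∀ z → z ≢ p → z ≢ q → h z ≡ g z) → count h ≡ count g
count-swap g h p q hp hq rest =
  trans (count-cong swapped) (count-permute g (Perm.transpose p q))
  where
  transpose-p : PermC.transpose p q p ≡ q
  transpose-p rewrite dec-true (p ≟ p) refl = refl

  transpose-q : PermC.transpose p q q ≡ p
  transpose-q with q ≟ p
  ... | yes q≡p = q≡p
  ... | no _ rewrite dec-true (q ≟ q) refl = refl

  transpose-other : ∀ z → z ≢ p → z ≢ q → PermC.transpose p q z ≡ z
  transpose-other z z≢p z≢q rewrite dec-false (z ≟ p) z≢p | dec-false (z ≟ q) z≢q = refl

  swapped : ∀ z → h z ≡ g (PermC.transpose p q z)
  swapped z = by-cases (z ≟ p) (z ≟ q)
    where
    by-cases : Dec (z ≡ p) → Dec (z ≡ q) → h z ≡ g (PermC.transpose p q z)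
    by-cases (yes refl) _          rewrite transpose-p = hp
    by-cases (no _)     (yes refl) rewrite transpose-q = hq
    by-cases (no z≢p)   (no z≢q)   rewrite transpose-other z z≢p z≢q = rest z z≢p z≢q

deg≡count : ∀ {n} (G : Graph n) v → deg G v ≡ count (adj G v)
deg≡count G v = length-filter (λ i → i) (adj G v)
  where
  length-filter : ∀ {A : Set} {n} (f : Fin n → A) (h : A → Bool) →
    length (filter (λ u → h u Bool.≟ true) (tabulate f)) ≡ count (λ i → h (f i))
  length-filter {n = zero}  f h = refl
  length-filter {n = suc n} f h with h (f zero)
  ... | true  = cong suc (length-filter (λ i → f (suc i)) h)
  ... | false = length-filter (λ i → f (suc i)) h


module Reachability {n} (G : Graph n) where

  adj-sym : ∀ {x y} → adj G x y ≡ true → adj G y x ≡ true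
  adj-sym {x} {y} e = trans (symmetric G y x) e

  adj⇒≢ : ∀ {x y} → adj G x y ≡ true → x ≢ y
  adj⇒≢ {x} e refl = true≢false (trans (sym e) (irrefl G x))

  edge : ∀ {x y} → adj G x y ≡ true → Reach G x y
  edge e = step (toT e) here

  reach-snoc : ∀ {x y z} → Reach G x y → adj G y z ≡ true → Reach G x z
  reach-snoc here       e = edge e
  reach-snoc (step a r) e = step a (reach-snoc r e)

  reach-trans : ∀ {x y z} → Reach G x y → Reach G y z → Reach G x z
  reach-trans here       r′ = r′
  reach-trans (step a r) r′ = step a (reach-trans r r′)

  reach-sym : ∀ {x y} → Reach G x y → Reach G y x
  reach-sym here       = here
  reach-sym (step a r) = reach-snoc (reach-sym r) (adj-sym (fromT a))

  -- Breadth-first search: `within k x z` holds iff z is reachable from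
  -- x in at most k steps.
  within : ℕ → Fin n → Fin n → Bool
  within zero    x z = x == z
  within (suc k) x z = within k x z ∨ does (any? (λ y → (within k x y ∧ adj G y z) Bool.≟ true))

  within-sound : ∀ k x z → within k x z ≡ true → Reach G x z
  within-sound zero    x z e rewrite ==-sound {x = x} {z} e = here
  within-sound (suc k) x z e with ∨-elim (within k x z) e
  ... | inj₁ e′ = within-sound k x z e′
  ... | inj₂ e′ with any? (λ y → (within k x y ∧ adj G y z) Bool.≟ true)
  ... | yes (y , ey) = reach-snoc (within-sound k x y (proj₁ (∧-elim _ ey))) (proj₂ (∧-elim _ ey))

  within-self : ∀ k x → within k x x ≡ true
  within-self zero    x = ==-refl x
  within-self (suc k) x = ∨-introˡ (within-self k x)

  within-step : ∀ k x y z → within k x y ≡ true → adj G y z ≡ true → within (suc k) x z ≡ true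
  within-step k x y z xy yz =
    ∨-introʳ (within k x z) (dec-true (any? (λ w → (within k x w ∧ adj G w z) Bool.≟ true)) (y , ∧-intro xy yz))

  Converged : ℕ → Fin n → Set
  Converged j x = ∀ z → within (suc j) x z ≡ true → within j x z ≡ true

  converged-complete : ∀ j x → Converged j x → ∀ {y z} → within j x y ≡ true → Reach G y z → within j x z ≡ true
  converged-complete j x conv e here = e
  converged-complete j x conv {y} e (step {w = w} a r) =
    converged-complete j x conv (conv w (within-step j x y w e (fromT a))) r

  converged-or-grows : ∀ j x → Converged j x ⊎ count (within j x) < count (within (suc j) x)
  converged-or-grows j x with ⊆-or-new (within (suc j) x) (within j x)
  ... | inj₁ ⊆ = inj₁ ⊆
  ... | inj₂ (z , new , old) = inj₂ (count-< (λ _ → ∨-introˡ) z old new)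

  converged-or-large : ∀ x k → (∃ λ j → Converged j x) ⊎ k < count (within k x)
  converged-or-large x zero = inj₂ (count-pos _ x (within-self zero x))
  converged-or-large x (suc k) with converged-or-large x k
  ... | inj₁ done = inj₁ done
  ... | inj₂ large with converged-or-grows k x
  ...   | inj₁ conv   = inj₁ (k , conv)
  ...   | inj₂ grows = inj₂ (<-≤-trans (s≤s large) grows)

  -- There are only n vertices, so the search converges by level n.
  converges : ∀ x → ∃ λ j → Converged j x
  converges x with converged-or-large x n
  ... | inj₁ done  = done
  ... | inj₂ large = ⊥-elim (<⇒≱ large (count≤n (within n x)))

  reach? : ∀ x y → Dec (Reach G x y)
  reach? x y with converges x
  ... | j , conv with within j x y in e
  ... | true  = yes (within-sound j x y e)
  ... | false = no λ r → true≢false (trans (sym (converged-complete j x conv (within-self j x) r)) e)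

  reachᵇ : Fin n → Fin n → Bool
  reachᵇ x y = does (reach? x y)

  reachᵇ-complete : ∀ {x y} → Reach G x y → reachᵇ x y ≡ true
  reachᵇ-complete {x} {y} = dec-true (reach? x y)

  reachᵇ-sound : ∀ {x y} → reachᵇ x y ≡ true → Reach G x y
  reachᵇ-sound {x} {y} e with reach? x y
  ... | yes r = r


pairCount : ∀ {n} → (Fin n → Fin n → Bool) → ℕ
pairCount Q = ∑ (λ x → count (Q x))

pairCount-permute : ∀ {n} (π : Fin n ↔ Fin n) (P Q : Fin n → Fin n → Bool) →
  (∀ x y → P x y ≡ Q (Inverse.to π x) (Inverse.to π y)) → pairCount P ≡ pairCount Q
pairCount-permute π P Q e = begin
  ∑ (λ x → count (P x))                   ≡⟨ ℕ-Sum.sum-cong-≗ (λ x → count-cong (e x)) ⟩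
  ∑ (λ x → count (λ y → Q (σ x) (σ y)))   ≡⟨ ℕ-Sum.sum-cong-≗ (λ x → count-permute (Q (σ x)) π) ⟩
  ∑ (λ x → count (Q (σ x)))               ≡⟨ ∑-permute (λ x → count (Q x)) π ⟩
  ∑ (λ x → count (Q x))                   ∎
  where
  open ≡-Reasoning
  σ = Inverse.to π

pairCount-< : ∀ {n} {P Q : Fin n → Fin n → Bool} → (∀ x y → P x y ≡ true → Q x y ≡ true) →
  ∀ x y → P x y ≡ false → Q x y ≡ true → pairCount P < pairCount Q
pairCount-< P⊆Q x y Pxy Qxy =
  ∑-mono-< (λ x′ → ∑-mono (λ y′ → 𝟙-mono (P⊆Q x′ y′))) x (count-< (P⊆Q x) y Pxy Qxy)

sameComponent : ∀ {n} → Graph n → Fin n → Fin n → Bool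
sameComponent G = Reachability.reachᵇ G

isolatedEdge : ∀ {n} → Graph n → Fin n → Fin n → Bool
isolatedEdge G x y = adj G x y ∧ (deg G x ≡ᵇ 1) ∧ (deg G y ≡ᵇ 1)

module IsoTransport {n} (H G : Graph n) (iso : Isomorphic H G) where

  private
    π = proj₁ iso
    f = Inverse.to π
    g = Inverse.from π

    adj-preserved : ∀ u v → adj G (f u) (f v) ≡ adj H u v
    adj-preserved = proj₂ iso

    adj-reflected : ∀ p q → adj H (g p) (g q) ≡ adj G p q
    adj-reflected p q = trans (sym (adj-preserved (g p) (g q)))
                              (cong₂ (adj G) (Inverse.strictlyInverseˡ π p) (Inverse.strictlyInverseˡ π q))

    reach-to : ∀ {x y} → Reach H x y → Reach G (f x) (f y)
    reach-to here = here
    reach-to {x} (step {w = w} a r) = step (toT (trans (adj-preserved x w) (fromT a))) (reach-to r)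

    reach-back : ∀ {p q} → Reach G p q → Reach H (g p) (g q)
    reach-back here = here
    reach-back {p} (step {w = w} a r) = step (toT (trans (adj-reflected p w) (fromT a))) (reach-back r)

    reach-from : ∀ {x y} → Reach G (f x) (f y) → Reach H x y
    reach-from {x} {y} r = subst₂ (Reach H) (Inverse.strictlyInverseʳ π x) (Inverse.strictlyInverseʳ π y) (reach-back r)

    deg-preserved : ∀ x → deg H x ≡ deg G (f x)
    deg-preserved x = begin
      deg H x                              ≡⟨ deg≡count H x ⟩
      count (adj H x)                      ≡⟨ count-cong (λ y → sym (adj-preserved x y)) ⟩
      count (λ y → adj G (f x) (f y))      ≡⟨ count-permute (adj G (f x)) π ⟩
      count (adj G (f x))                  ≡⟨ sym (deg≡count G (f x)) ⟩
      deg G (f x)                          ∎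
      where open ≡-Reasoning

  sameComponent-invariant : pairCount (sameComponent H) ≡ pairCount (sameComponent G)
  sameComponent-invariant = pairCount-permute π _ _ λ x y →
    ⇔→≡ (mk⇔ (λ e → Reachability.reachᵇ-complete G (reach-to (Reachability.reachᵇ-sound H e)))
             (λ e → Reachability.reachᵇ-complete H (reach-from (Reachability.reachᵇ-sound G e))))

  isolatedEdge-invariant : pairCount (isolatedEdge H) ≡ pairCount (isolatedEdge G)
  isolatedEdge-invariant = pairCount-permute π _ _ λ x y →
    sym (cong₂ (λ a d → a ∧ d) (adj-preserved x y)
               (cong₂ (λ dx dy → (dx ≡ᵇ 1) ∧ (dy ≡ᵇ 1)) (sym (deg-preserved x)) (sym (deg-preserved y))))


isPair : ∀ {n} → Fin n → Fin n → Fin n → Fin n → Bool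
isPair p q x y = (x == p ∧ y == q) ∨ (x == q ∧ y == p)

isPair-sym : ∀ {n} (p q x y : Fin n) → isPair p q x y ≡ isPair p q y x
isPair-sym p q x y rewrite ∧-comm (x == p) (y == q) | ∧-comm (x == q) (y == p) =
  ∨-comm (y == q ∧ x == p) (y == p ∧ x == q)

isPair-true : ∀ {n} {p q : Fin n} x y → isPair p q x y ≡ true → (x ≡ p × y ≡ q) ⊎ (x ≡ q × y ≡ p)
isPair-true {p = p} {q} x y e with ∨-elim (x == p ∧ y == q) e
... | inj₁ e′ = inj₁ (==-sound (proj₁ (∧-elim _ e′)) , ==-sound (proj₂ (∧-elim _ e′)))
... | inj₂ e′ = inj₂ (==-sound (proj₁ (∧-elim _ e′)) , ==-sound (proj₂ (∧-elim _ e′)))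

isPair-false : ∀ {n} {p q : Fin n} x y → (x ≡ p → y ≡ q → ⊥) → (x ≡ q → y ≡ p → ⊥) → isPair p q x y ≡ false
isPair-false x y not-pq not-qp = ¬true⇒false λ e → [_,_] (uncurry not-pq) (uncurry not-qp) (isPair-true x y e)

isPair-offˡ : ∀ {n} {p q : Fin n} x y → x ≢ p → x ≢ q → isPair p q x y ≡ false
isPair-offˡ x y x≢p x≢q = isPair-false x y (λ e _ → x≢p e) (λ e _ → x≢q e)

isPair-offʳ : ∀ {n} {p q : Fin n} x y → y ≢ p → y ≢ q → isPair p q x y ≡ false
isPair-offʳ x y y≢p y≢q = isPair-false x y (λ _ e → y≢q e) (λ _ e → y≢p e)

isPair-rowˡ : ∀ {n} {p q : Fin n} z → p ≢ q → z ≢ q → isPair p q p z ≡ false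
isPair-rowˡ z p≢q z≢q = isPair-false _ z (λ _ e → z≢q e) (λ e _ → p≢q e)

isPair-rowʳ : ∀ {n} {p q : Fin n} z → p ≢ q → z ≢ p → isPair p q q z ≡ false
isPair-rowʳ z p≢q z≢p = isPair-false _ z (λ e _ → p≢q (sym e)) (λ _ e → z≢p e)

isPair-pq : ∀ {n} (p q : Fin n) → isPair p q p q ≡ true
isPair-pq p q rewrite ==-refl p | ==-refl q = refl

isPair-qp : ∀ {n} (p q : Fin n) → isPair p q q p ≡ true
isPair-qp p q rewrite ==-refl p | ==-refl q = ∨-zeroʳ _

isPair-irrefl : ∀ {n} {p q : Fin n} x → p ≢ q → isPair p q x x ≡ false
isPair-irrefl x p≢q = isPair-false x x (λ e₁ e₂ → p≢q (trans (sym e₁) e₂)) (λ e₁ e₂ → p≢q (trans (sym e₂) e₁))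

deleteEdge : ∀ {n} → Graph n → Fin n → Fin n → Graph n
deleteEdge G a b = record
  { adj       = λ x y → adj G x y ∧ not (isPair a b x y)
  ; symmetric = λ x y → cong₂ (λ s t → s ∧ not t) (symmetric G x y) (isPair-sym a b x y)
  ; irrefl    = λ v → cong (λ s → s ∧ not (isPair a b v v)) (irrefl G v)
  }

module TwoSwitch {n} (G : Graph n) {a b c d : Fin n}
  (ab : adj G a b ≡ true) (cd : adj G c d ≡ true)
  (a≢c : a ≢ c) (a≢d : a ≢ d) (b≢c : b ≢ c) (b≢d : b ≢ d)
  (ac : adj G a c ≡ false) (bd : adj G b d ≡ false) where

  open Reachability G using (adj-sym; adj⇒≢)

  private
    a≢b : a ≢ b
    a≢b = adj⇒≢ ab
    c≢d : c ≢ d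
    c≢d = adj⇒≢ cd

  switchedAdj : Fin n → Fin n → Bool
  switchedAdj x y = not (isPair a b x y ∨ isPair c d x y) ∧ (isPair a c x y ∨ isPair b d x y ∨ adj G x y)

  switched : Graph n
  switched = record
    { adj       = switchedAdj
    ; symmetric = λ x y → symmetric′ x y
    ; irrefl    = λ v → irrefl′ v
    }
    where
    symmetric′ : ∀ x y → switchedAdj x y ≡ switchedAdj y x
    symmetric′ x y rewrite isPair-sym a b x y | isPair-sym c d x y | isPair-sym a c x y
                         | isPair-sym b d x y | symmetric G x y = refl
    irrefl′ : ∀ v → switchedAdj v v ≡ false
    irrefl′ v rewrite isPair-irrefl {p = a} {c} v a≢c | isPair-irrefl {p = b} {d} v b≢d | irrefl G v =
      ∧-zeroʳ _

  removes-ab : ∀ x y → isPair a b x y ≡ true → switchedAdj x y ≡ false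
  removes-ab x y e rewrite e = refl

  removes-cd : ∀ x y → isPair c d x y ≡ true → switchedAdj x y ≡ false
  removes-cd x y e rewrite e | ∨-zeroʳ (isPair a b x y) = refl

  unchanged : ∀ x y → isPair a b x y ≡ false → isPair c d x y ≡ false →
              isPair a c x y ≡ false → isPair b d x y ≡ false → switchedAdj x y ≡ adj G x y
  unchanged x y e₁ e₂ e₃ e₄ rewrite e₁ | e₂ | e₃ | e₄ = refl

  keeps : ∀ x y → isPair a b x y ≡ false → isPair c d x y ≡ false → adj G x y ≡ true → switchedAdj x y ≡ true
  keeps x y e₁ e₂ e₃ rewrite e₁ | e₂ | e₃ | ∨-zeroʳ (isPair b d x y) | ∨-zeroʳ (isPair a c x y) = refl

  edge-fate : ∀ x y → adj G x y ≡ true →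
              isPair a b x y ≡ true ⊎ isPair c d x y ≡ true ⊎ switchedAdj x y ≡ true
  edge-fate x y xy = by-cases (isPair a b x y) refl (isPair c d x y) refl
    where
    by-cases : ∀ s → isPair a b x y ≡ s → ∀ t → isPair c d x y ≡ t →
               isPair a b x y ≡ true ⊎ isPair c d x y ≡ true ⊎ switchedAdj x y ≡ true
    by-cases true  e₁ _     _  = inj₁ e₁
    by-cases false _  true  e₂ = inj₂ (inj₁ e₂)
    by-cases false e₁ false e₂ = inj₂ (inj₂ (keeps x y e₁ e₂ xy))

  adds-ac : switchedAdj a c ≡ true
  adds-ac rewrite isPair-offʳ {p = a} {b} a c (≢-sym a≢c) (≢-sym b≢c) | isPair-offˡ {p = c} {d} a c a≢c a≢d
                | isPair-pq a c = refl

  adds-bd : switchedAdj b d ≡ true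
  adds-bd rewrite isPair-offʳ {p = a} {b} b d (≢-sym a≢d) (≢-sym b≢d) | isPair-offˡ {p = c} {d} b d b≢c b≢d
                | isPair-pq b d = ∨-zeroʳ _

  private
    adds-ca : switchedAdj c a ≡ true
    adds-ca = trans (symmetric switched c a) adds-ac

    adds-db : switchedAdj d b ≡ true
    adds-db = trans (symmetric switched d b) adds-bd

    -- In each of the four affected rows two entries are exchanged.
    row-a : count (switchedAdj a) ≡ count (adj G a)
    row-a = count-swap (adj G a) (switchedAdj a) b c
      (trans (removes-ab a b (isPair-pq a b)) (sym ac)) (trans adds-ac (sym ab))
      (λ z z≢b z≢c → unchanged a z (isPair-rowˡ z a≢b z≢b) (isPair-offˡ a z a≢c a≢d)
                                   (isPair-rowˡ z a≢c z≢c) (isPair-offˡ a z a≢b a≢d))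

    row-b : count (switchedAdj b) ≡ count (adj G b)
    row-b = count-swap (adj G b) (switchedAdj b) a d
      (trans (removes-ab b a (isPair-qp a b)) (sym bd)) (trans adds-bd (sym (adj-sym ab)))
      (λ z z≢a z≢d → unchanged b z (isPair-rowʳ z a≢b z≢a) (isPair-offˡ b z b≢c b≢d)
                                   (isPair-offˡ b z (≢-sym a≢b) b≢c) (isPair-rowˡ z b≢d z≢d))

    row-c : count (switchedAdj c) ≡ count (adj G c)
    row-c = count-swap (adj G c) (switchedAdj c) d a
      (trans (removes-cd c d (isPair-pq c d)) (sym (trans (symmetric G c a) ac))) (trans adds-ca (sym cd))
      (λ z z≢d z≢a → unchanged c z (isPair-offˡ c z (≢-sym a≢c) (≢-sym b≢c)) (isPair-rowˡ z c≢d z≢d)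
                                   (isPair-rowʳ z a≢c z≢a) (isPair-offˡ c z (≢-sym b≢c) c≢d))

    row-d : count (switchedAdj d) ≡ count (adj G d)
    row-d = count-swap (adj G d) (switchedAdj d) c b
      (trans (removes-cd d c (isPair-qp c d)) (sym (trans (symmetric G d b) bd))) (trans adds-db (sym (adj-sym cd)))
      (λ z z≢c z≢b → unchanged d z (isPair-offˡ d z (≢-sym a≢d) (≢-sym b≢d)) (isPair-rowʳ z c≢d z≢c)
                                   (isPair-offˡ d z (≢-sym a≢d) (≢-sym c≢d)) (isPair-rowʳ z b≢d z≢b))

    row : ∀ x → count (switchedAdj x) ≡ count (adj G x)
    row x = by-cases (x ≟ a) (x ≟ b) (x ≟ c) (x ≟ d)
      where
      by-cases : Dec (x ≡ a) → Dec (x ≡ b) → Dec (x ≡ c) → Dec (x ≡ d) → count (switchedAdj x) ≡ count (adj G x)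
      by-cases (yes refl) _ _ _ = row-a
      by-cases (no _) (yes refl) _ _ = row-b
      by-cases (no _) (no _) (yes refl) _ = row-c
      by-cases (no _) (no _) (no _) (yes refl) = row-d
      by-cases (no x≢a) (no x≢b) (no x≢c) (no x≢d) = count-cong λ z →
        unchanged x z (isPair-offˡ x z x≢a x≢b) (isPair-offˡ x z x≢c x≢d)
                      (isPair-offˡ x z x≢a x≢c) (isPair-offˡ x z x≢b x≢d)

  deg-switched : ∀ x → deg switched x ≡ deg G x
  deg-switched x = trans (deg≡count switched x) (trans (row x) (sym (deg≡count G x)))


memᵇ : ∀ {n} → Fin n → List (Fin n) → Bool
memᵇ z []       = false
memᵇ z (x ∷ xs) = z == x ∨ memᵇ z xs

-- Every component with at least two vertices contains a terminal edge:
-- extend a simple path from u until its end e has no unvisited neighbour;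
-- then either e is a leaf or it closes a cycle through its last edge.
module TerminalEdges {n} (G : Graph n) (u : Fin n) where

  open Reachability G

  -- A simple path, listed from its last vertex back to its first.
  data Path : List (Fin n) → Set where
    start  : ∀ x → Path (x ∷ [])
    extend : ∀ {y ys} e → Path (y ∷ ys) → adj G y e ≡ true → memᵇ e (y ∷ ys) ≡ false → Path (e ∷ y ∷ ys)

  AllReachable : List (Fin n) → Set
  AllReachable L = ∀ z → memᵇ z L ≡ true → Reach G u z

  -- An edge ab in the component of u such that either b is a leaf
  -- hanging off a, or ab lies on a cycle (deleting it keeps a and b connected).
  data TerminalEdge : Set where
    leaf    : ∀ a b → adj G a b ≡ true → Reach G u a → (∀ z → adj G b z ≡ true → z ≡ a) → TerminalEdge
    onCycle : ∀ a b → adj G a b ≡ true → Reach G u a → Reach (deleteEdge G a b) a b → TerminalEdge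

  -- The number of vertices not on the path: decreases as the path grows.
  unvisited : List (Fin n) → ℕ
  unvisited L = count (λ z → not (memᵇ z L))

  unvisited-< : ∀ z L → memᵇ z L ≡ false → unvisited (z ∷ L) < unvisited L
  unvisited-< z L z∉L = count-< (λ w → shrink (w == z)) z (cong (λ t → not (t ∨ memᵇ z L)) (==-refl z)) (cong not z∉L)
    where
    shrink : ∀ a {b} → not (a ∨ b) ≡ true → not b ≡ true
    shrink false e = e

  reachable-cons : ∀ z L → AllReachable L → Reach G u z → AllReachable (z ∷ L)
  reachable-cons z L all-L u↝z x x∈ with ∨-elim (x == z) x∈
  ... | inj₁ x≡z rewrite ==-sound {x = x} {z} x≡z = u↝z
  ... | inj₂ x∈L = all-L x x∈L

  path-avoiding : ∀ (e p : Fin n) {h L} → Path (h ∷ L) → memᵇ e (h ∷ L) ≡ false →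
                  ∀ z → memᵇ z (h ∷ L) ≡ true → Reach (deleteEdge G e p) z h
  path-avoiding e p (start x) _ z z∈ with ∨-elim (z == x) z∈
  ... | inj₁ z≡x rewrite ==-sound {x = z} {x} z≡x = here
  path-avoiding e p {h} (extend {y} .h path yh h∉) e∉ z z∈ with ∨-elim (z == h) z∈
  ... | inj₁ z≡h rewrite ==-sound {x = z} {h} z≡h = here
  ... | inj₂ z∈rest with ∨-false (e == h) e∉
  ... | e≢h , e∉rest =
    Reachability.reach-snoc (deleteEdge G e p) (path-avoiding e p path e∉rest z z∈rest) kept
    where
    kept : adj G y h ∧ not (isPair e p y h) ≡ true
    kept rewrite yh | isPair-false {p = e} {p} y h (λ y≡e _ → ==-false⇒≢ (proj₁ (∨-false (e == y) e∉rest)) (sym y≡e))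
                                                    (λ _ h≡e → ==-false⇒≢ e≢h (sym h≡e)) = refl

  closes-cycle : ∀ {e p rest} → Path (e ∷ p ∷ rest) → ∀ z → adj G e z ≡ true → z ≢ p →
                 memᵇ z (e ∷ p ∷ rest) ≡ true → Reach (deleteEdge G e p) e p
  closes-cycle {e} {p} {rest} (extend .e path pe e∉) z ez z≢p z∈ =
    step (toT first) (path-avoiding e p path e∉ z z∈path)
    where
    z∈path : memᵇ z (p ∷ rest) ≡ true
    z∈path with ∨-elim (z == e) z∈
    ... | inj₁ z≡e = ⊥-elim (adj⇒≢ ez (sym (==-sound z≡e)))
    ... | inj₂ z∈  = z∈
    first : adj G e z ∧ not (isPair e p e z) ≡ true
    first rewrite ez | isPair-rowˡ {p = e} {p} z (λ e≡p → adj⇒≢ pe (sym e≡p)) z≢p = refl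

  -- Extend the path while its end has an unvisited neighbour; otherwise the
  -- last edge is terminal.  `fuel` bounds the number of unvisited vertices.
  grow : ∀ (fuel : ℕ) e p rest → Path (e ∷ p ∷ rest) → AllReachable (e ∷ p ∷ rest) →
         unvisited (e ∷ p ∷ rest) < fuel → TerminalEdge
  grow (suc fuel) e p rest path reach bound with ⊆-or-new (adj G e) (λ z → memᵇ z (e ∷ p ∷ rest))
  ... | inj₂ (z , ez , fresh) =
    grow fuel z e (p ∷ rest) (extend z path ez fresh)
         (reachable-cons z (e ∷ p ∷ rest) reach (reach-snoc (reach e (∨-introˡ (==-refl e))) ez))
         (<-≤-trans (unvisited-< z (e ∷ p ∷ rest) fresh) (m<1+n⇒m≤n bound))
  ... | inj₁ visited with path | ⊆-or-new (adj G e) (_== p)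
  ...   | extend .e _ pe _ | inj₁ only-p =
    leaf p e pe (reach p (∨-introʳ (p == e) (∨-introˡ (==-refl p)))) (λ z ez → ==-sound (only-p z ez))
  ...   | extend .e _ pe _ | inj₂ (z , ez , z≠p) =
    onCycle e p (adj-sym pe) (reach e (∨-introˡ (==-refl e)))
            (closes-cycle path z ez (==-false⇒≢ z≠p) (visited z ez))

  first-step : ∀ {z} → Reach G u z → z ≢ u → ∃ λ w → adj G u w ≡ true
  first-step here                 z≢u = ⊥-elim (z≢u refl)
  first-step (step {w = w} uw _) _   = w , fromT uw

  has-neighbour : ∀ {k} → ComponentAtLeast G (suc (suc k)) u → ∃ λ w → adj G u w ≡ true
  has-neighbour (z₁ ∷ z₂ ∷ _ , ((z₁≢z₂ ∷ _) ∷ _) , (u↝z₁ ∷ u↝z₂ ∷ _) , _) with z₁ ≟ u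
  ... | yes refl = first-step u↝z₂ (λ z₂≡u → z₁≢z₂ (sym z₂≡u))
  ... | no z₁≢u  = first-step u↝z₁ z₁≢u
  has-neighbour (_ ∷ [] , _ , _ , s≤s ())
  has-neighbour ([] , _ , _ , ())

  terminalEdge : ∀ {k} → ComponentAtLeast G (suc (suc k)) u → TerminalEdge
  terminalEdge comp with has-neighbour comp
  ... | w , uw = grow (suc (unvisited (w ∷ u ∷ []))) w u [] (extend w (start u) uw w∉) reach ≤-refl
    where
    w∉ : memᵇ w (u ∷ []) ≡ false
    w∉ rewrite ==-false {x = w} {u} (λ w≡u → adj⇒≢ uw (sym w≡u)) = refl
    reach : AllReachable (w ∷ u ∷ [])
    reach = reachable-cons w (u ∷ []) (reachable-cons u [] (λ _ ()) here) (edge uw)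


unique-neighbour : ∀ {n} (G : Graph n) {x y} → adj G x y ≡ true → deg G x ≡ 1 →
                   ∀ z → adj G x z ≡ true → z ≡ y
unique-neighbour G {x} {y} xy deg₁ z xz with z ≟ y
... | yes z≡y = z≡y
... | no z≢y with ≤-trans (count≥2 (adj G x) y z xy xz (λ y≡z → z≢y (sym y≡z)))
                          (≤-reflexive (trans (sym (deg≡count G x)) deg₁))
... | s≤s ()

leaf-degree : ∀ {n} (G : Graph n) {x y} → adj G x y ≡ true → (∀ z → adj G x z ≡ true → z ≡ y) → deg G x ≡ 1
leaf-degree G {x} {y} xy only = trans (deg≡count G x) (count-singleton (adj G x) y xy only)

-- If both ends of the edge xy have degree one, the component of x is {x, y};
-- so it cannot contain three distinct vertices.
no-isolated-edge : ∀ {n} (G : Graph n) {u x y} → ComponentAtLeast G 3 u → Reach G u x →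
                   adj G x y ≡ true → deg G x ≡ 1 → deg G y ≡ 1 → ⊥
no-isolated-edge G {u} {x} {y} (z₁ ∷ z₂ ∷ z₃ ∷ _ , ((z₁≢z₂ ∷ z₁≢z₃ ∷ _) ∷ (z₂≢z₃ ∷ _) ∷ _) , (r₁ ∷ r₂ ∷ r₃ ∷ _) , _)
                 u↝x xy deg-x deg-y = pigeonhole (confined r₁) (confined r₂) (confined r₃)
  where
  open Reachability G
  InEdge : Fin _ → Set
  InEdge z = z ≡ x ⊎ z ≡ y
  stays : ∀ {w z} → InEdge w → Reach G w z → InEdge z
  stays w∈ here = w∈
  stays (inj₁ refl) (step {w = w} a r) = stays (inj₂ (unique-neighbour G xy deg-x w (fromT a))) r
  stays (inj₂ refl) (step {w = w} a r) = stays (inj₁ (unique-neighbour G (adj-sym xy) deg-y w (fromT a))) r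
  confined : ∀ {z} → Reach G u z → InEdge z
  confined u↝z = stays (inj₁ refl) (reach-trans (reach-sym u↝x) u↝z)
  pigeonhole : InEdge z₁ → InEdge z₂ → InEdge z₃ → ⊥
  pigeonhole (inj₁ refl) (inj₁ refl) _ = z₁≢z₂ refl
  pigeonhole (inj₂ refl) (inj₂ refl) _ = z₁≢z₂ refl
  pigeonhole (inj₁ refl) _ (inj₁ refl) = z₁≢z₃ refl
  pigeonhole (inj₂ refl) _ (inj₂ refl) = z₁≢z₃ refl
  pigeonhole _ (inj₁ refl) (inj₁ refl) = z₂≢z₃ refl
  pigeonhole _ (inj₂ refl) (inj₂ refl) = z₂≢z₃ refl
no-isolated-edge G (_ ∷ _ ∷ [] , _ , _ , s≤s (s≤s ())) _ _ _ _
no-isolated-edge G (_ ∷ [] , _ , _ , s≤s ()) _ _ _ _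
no-isolated-edge G ([] , _ , _ , ()) _ _ _ _


module SwitchAcrossComponents {n} (G : Graph n) (unigraph : Unigraph G) {a b c d : Fin n}
  (ab : adj G a b ≡ true) (cd : adj G c d ≡ true) (a↝̸c : ¬ Reach G a c) where

  open Reachability G

  private
    a≢c : a ≢ c
    a≢c refl = a↝̸c here
    a≢d : a ≢ d
    a≢d refl = a↝̸c (edge (adj-sym cd))
    b≢c : b ≢ c
    b≢c refl = a↝̸c (edge ab)
    b≢d : b ≢ d
    b≢d refl = a↝̸c (step (toT ab) (edge (adj-sym cd)))

    ac : adj G a c ≡ false
    ac = ¬true⇒false λ a~c → a↝̸c (edge a~c)

    bd : adj G b d ≡ false
    bd = ¬true⇒false λ b~d → a↝̸c (step (toT ab) (step (toT b~d) (edge (adj-sym cd))))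

  open TwoSwitch G ab cd a≢c a≢d b≢c b≢d ac bd

  -- The 2-switch has the same degree sequence, hence is isomorphic to G.
  private
    switched≅G : Isomorphic switched G
    switched≅G = unigraph switched (↭-reflexive (map-cong deg-switched (allFin n)))

  open IsoTransport switched G switched≅G

  private
    module Switched = Reachability switched

  connections-survive : Reach (deleteEdge G a b) a b → ∀ {x y} → Reach G x y → Reach switched x y
  connections-survive a↝b = preserved
    where
    -- The detour around the cycle avoids the component of c, hence uses
    -- no switched pair.
    detour : ∀ {x y} → Reach G a x → Reach (deleteEdge G a b) x y → Reach switched x y
    detour a↝x here = here
    detour {x} a↝x (step {w = w} s r) with ∧-elim (adj G x w) (fromT s)
    ... | xw , not-ab = step (toT (keeps x w (not-true not-ab) (isPair-offˡ x w x≢c x≢d) xw)) (detour (reach-snoc a↝x xw) r)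
      where
      x≢c : x ≢ c
      x≢c refl = a↝̸c a↝x
      x≢d : x ≢ d
      x≢d refl = a↝̸c (reach-snoc a↝x (adj-sym cd))
    a↝b′ : Reach switched a b
    a↝b′ = detour here a↝b
    c↝d′ : Reach switched c d
    c↝d′ = step (toT (trans (symmetric switched c a) adds-ac)) (Switched.reach-trans a↝b′ (Switched.edge adds-bd))
    edge-preserved : ∀ x y → adj G x y ≡ true → Reach switched x y
    edge-preserved x y xy with edge-fate x y xy
    ... | inj₁ was-ab with isPair-true x y was-ab
    ...   | inj₁ (refl , refl) = a↝b′
    ...   | inj₂ (refl , refl) = Switched.reach-sym a↝b′
    edge-preserved x y xy | inj₂ (inj₁ was-cd) with isPair-true x y was-cd
    ...   | inj₁ (refl , refl) = c↝d′
    ...   | inj₂ (refl , refl) = Switched.reach-sym c↝d′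
    edge-preserved x y xy | inj₂ (inj₂ kept) = Switched.edge kept
    preserved : ∀ {x y} → Reach G x y → Reach switched x y
    preserved here = here
    preserved {x} (step {w = w} s r) = Switched.reach-trans (edge-preserved x w (fromT s)) (preserved r)

  -- Since a and c also become connected, the switch would have more
  -- connected pairs than G, contradicting isomorphism.
  on-cycle-impossible : Reach (deleteEdge G a b) a b → ⊥
  on-cycle-impossible a↝b = <-irrefl (sym sameComponent-invariant)
    (pairCount-< (λ x y e → Switched.reachᵇ-complete (connections-survive a↝b (reachᵇ-sound e))) a c
                 (dec-false (reach? a c) a↝̸c) (Switched.reachᵇ-complete (Switched.edge adds-ac)))

  isolated-edges-survive : (deg G a ≡ 1 → deg G b ≡ 1 → ⊥) → (deg G c ≡ 1 → deg G d ≡ 1 → ⊥) →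
                           ∀ x y → isolatedEdge G x y ≡ true → isolatedEdge switched x y ≡ true
  isolated-edges-survive ab-not-isolated cd-not-isolated x y e with ∧-elim (adj G x y) e
  ... | xy , degs with ∧-elim (deg G x ≡ᵇ 1) degs
  ... | dx , dy = ∧-intro {a = switchedAdj x y} (survives (≡ᵇ⇒≡ _ 1 (toT dx)) (≡ᵇ⇒≡ _ 1 (toT dy)))
                          (∧-intro (subst (λ m → (m ≡ᵇ 1) ≡ true) (sym (deg-switched x)) dx)
                                   (subst (λ m → (m ≡ᵇ 1) ≡ true) (sym (deg-switched y)) dy))
    where
    survives : deg G x ≡ 1 → deg G y ≡ 1 → switchedAdj x y ≡ true
    survives dx dy with edge-fate x y xy
    ... | inj₁ was-ab with isPair-true x y was-ab
    ...   | inj₁ (refl , refl) = ⊥-elim (ab-not-isolated dx dy)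
    ...   | inj₂ (refl , refl) = ⊥-elim (ab-not-isolated dy dx)
    survives dx dy | inj₂ (inj₁ was-cd) with isPair-true x y was-cd
    ...   | inj₁ (refl , refl) = ⊥-elim (cd-not-isolated dx dy)
    ...   | inj₂ (refl , refl) = ⊥-elim (cd-not-isolated dy dx)
    survives dx dy | inj₂ (inj₂ kept) = kept

  -- If moreover b and d are leaves, bd is a new isolated edge, so the switch
  -- would have more isolated-edge pairs than G, contradicting isomorphism.
  leaves-impossible : (∀ z → adj G b z ≡ true → z ≡ a) → (∀ z → adj G d z ≡ true → z ≡ c) →
                      (deg G a ≡ 1 → deg G b ≡ 1 → ⊥) → (deg G c ≡ 1 → deg G d ≡ 1 → ⊥) → ⊥
  leaves-impossible b-leaf d-leaf ab-not-isolated cd-not-isolated = <-irrefl (sym isolatedEdge-invariant)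
    (pairCount-< (isolated-edges-survive ab-not-isolated cd-not-isolated) b d absent-in-G present-after-switch)
    where
    deg≡1ᵇ : ∀ {m} → m ≡ 1 → (m ≡ᵇ 1) ≡ true
    deg≡1ᵇ refl = refl
    absent-in-G : isolatedEdge G b d ≡ false
    absent-in-G rewrite bd = refl
    present-after-switch : isolatedEdge switched b d ≡ true
    present-after-switch = ∧-intro {a = switchedAdj b d} adds-bd
      (∧-intro (deg≡1ᵇ (trans (deg-switched b) (leaf-degree G (adj-sym ab) b-leaf)))
               (deg≡1ᵇ (trans (deg-switched d) (leaf-degree G (adj-sym cd) d-leaf))))


-- Any two vertices whose components have at least three vertices are
-- connected: otherwise their terminal edges could be switched.
lemma1 : ∀ {n} (G : Graph n) → Disconnected G → Unigraph G →
         ∀ u v → ComponentAtLeast G 3 u → ComponentAtLeast G 3 v → Reach G u v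
lemma1 G _ unigraph u v comp-u comp-v with Reachability.reach? G u v
... | yes u↝v = u↝v
... | no u↝̸v = ⊥-elim (incompatible (TerminalEdges.terminalEdge G u comp-u) (TerminalEdges.terminalEdge G v comp-v))
  where
  open Reachability G
  open TerminalEdges using (leaf; onCycle)
  open SwitchAcrossComponents G unigraph using (on-cycle-impossible; leaves-impossible)

  apart : ∀ {a c} → Reach G u a → Reach G v c → ¬ Reach G a c
  apart u↝a v↝c a↝c = u↝̸v (reach-trans u↝a (reach-trans a↝c (reach-sym v↝c)))

  incompatible : TerminalEdges.TerminalEdge G u → TerminalEdges.TerminalEdge G v → ⊥
  incompatible (onCycle a b ab u↝a cycle) (leaf c d cd v↝c _) =
    on-cycle-impossible ab cd (apart u↝a v↝c) cycle
  incompatible (onCycle a b ab u↝a cycle) (onCycle c d cd v↝c _) =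
    on-cycle-impossible ab cd (apart u↝a v↝c) cycle
  incompatible (leaf a b ab u↝a _) (onCycle c d cd v↝c cycle) =
    on-cycle-impossible cd ab (λ c↝a → apart u↝a v↝c (reach-sym c↝a)) cycle
  incompatible (leaf a b ab u↝a b-leaf) (leaf c d cd v↝c d-leaf) =
    leaves-impossible ab cd (apart u↝a v↝c) b-leaf d-leaf
      (no-isolated-edge G comp-u u↝a ab) (no-isolated-edge G comp-v v↝c cd)
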